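{- Let $M$ be a binary matrix that is a $(2,*)$-matrix or a $(*,2)$-matrix and that has no two identical rows and no two identical columns. Suppose $M$ does not have the simultaneous consecutive ones property and contains none of the matrices $M_{2_1},M_{2_2},M_{3_1},M_{3_2},M_{3_3},M_{2_1}^T,M_{2_2}^T,M_{3_1}^T,M_{3_2}^T,M_{3_3}^T$. Then any two submatrices of $M$ that are isomorphic to some $M_{I_k}$ or $M_{I_k}^T$ ($k\ge1$) are pairwise disjoint, i.e. they share no row and no column of $M$.
   Context: A binary matrix has the consecutive ones property (C1P) for rows if its columns can be permuted so that in every row the $1$-entries occur consecutively; it has the C1P for columns if its rows can be permuted so that in every column the $1$-entries occur consecutively; it has the simultaneous consecutive ones property (SC1P) if it has both. A $(2,*)$-matrix has at most two ones in each column; a $(*,2)$-matrix has at most two ones in each row. Two matrices are isomorphic if one is obtained from the other by permuting rows and/or columns; $M$ contains $N$ if some submatrix of $M$ (obtained by selecting a subset of rows and a subset of columns) is isomorphic to $N$. For $k\ge1$, $M_{I_k}$ is the $(k+2)\times(k+2)$ binary matrix in which, for $1\le i\le k+1$, row $i$ has ones exactly in columns $i$ and $i+1$, and row $k+2$ has ones exactly in columns $1$ and $k+2$. The matrices (given row by row) are: $M_{2_1}$: $1100,\ 0110,\ 0111,\ 1101$; $M_{2_2}$: $11000,\ 01100,\ 00110,\ 01111,\ 11101$; $M_{3_1}$: $1100,\ 0110,\ 0101$; $M_{3_2}$: $11000,\ 01100,\ 00110,\ 01101$; $M_{3_3}$: $110000,\ 011000,\ 001100,\ 000110,\ 011101$.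 $N^T$ denotes the transpose. -}

module Defs where

open import Data.Bool using (Bool; true; false; _∨_; if_then_else_)
open import Data.Nat using (ℕ; zero; suc; _+_; _≡ᵇ_; _≤ᵇ_; _≤_)
open import Data.Fin using (Fin; toℕ) renaming (_≤_ to _≤ᶠ_)
open import Data.Fin.Permutation using (Permutation′; _⟨$⟩ʳ_)
open import Data.Vec using (Vec; []; _∷_; lookup)
open import Data.Product using (Σ; ∃; _×_; _,_)
open import Relation.Binary.PropositionalEquality using (_≡_)
open import Relation.Nullary using (¬_)
open import Function.Definitions using (Injective)

Matrix : ℕ → ℕ → Set
Matrix m n = Fin m → Fin n → Bool

transpose : ∀ {m n} → Matrix m n → Matrix n m
transpose M j i = M i j

countOnes : ∀ {n} → (Fin n → Bool) → ℕ
countOnes {zero}  f = 0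
countOnes {suc n} f = (if f Fin.zero then 1 else 0) + countOnes (λ i → f (Fin.suc i))

TwoStar : ∀ {m n} → Matrix m n → Set
TwoStar M = ∀ j → countOnes (λ i → M i j) ≤ 2

StarTwo : ∀ {m n} → Matrix m n → Set
StarTwo M = ∀ i → countOnes (λ j → M i j) ≤ 2

NoIdenticalRows : ∀ {m n} → Matrix m n → Set
NoIdenticalRows M = ∀ i i′ → (∀ j → M i j ≡ M i′ j) → i ≡ i′

NoIdenticalCols : ∀ {m n} → Matrix m n → Set
NoIdenticalCols M = ∀ j j′ → (∀ i → M i j ≡ M i j′) → j ≡ j′

C1PRows : ∀ {m n} → Matrix m n → Set
C1PRows {m} {n} M = Σ (Permutation′ n) λ σ →
  ∀ (i : Fin m) (a b c : Fin n) → a ≤ᶠ b → b ≤ᶠ c →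
    M i (σ ⟨$⟩ʳ a) ≡ true → M i (σ ⟨$⟩ʳ c) ≡ true → M i (σ ⟨$⟩ʳ b) ≡ true

C1PCols : ∀ {m n} → Matrix m n → Set
C1PCols M = C1PRows (transpose M)

SC1P : ∀ {m n} → Matrix m n → Set
SC1P M = C1PRows M × C1PCols M

record Submatrix {m n p q : ℕ} (M : Matrix m n) (N : Matrix p q) : Set where
  field
    rows     : Fin p → Fin m
    cols     : Fin q → Fin n
    rows-inj : Injective _≡_ _≡_ rows
    cols-inj : Injective _≡_ _≡_ cols
    match    : ∀ i j → M (rows i) (cols j) ≡ N i j
open Submatrix public

Contains : ∀ {m n p q} → Matrix m n → Matrix p q → Set
Contains M N = Submatrix M N

RowIn : ∀ {m n p q} {M : Matrix m n} {N : Matrix p q} → Submatrix M N → Fin m → Set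
RowIn S x = ∃ λ i → rows S i ≡ x

ColIn : ∀ {m n p q} {M : Matrix m n} {N : Matrix p q} → Submatrix M N → Fin n → Set
ColIn S y = ∃ λ j → cols S j ≡ y

SameSubmatrix : ∀ {m n p q p′ q′} {M : Matrix m n} {N : Matrix p q} {N′ : Matrix p′ q′} →
  Submatrix M N → Submatrix M N′ → Set
SameSubmatrix {m} {n} S T =
  (∀ (x : Fin m) → (RowIn S x → RowIn T x) × (RowIn T x → RowIn S x)) ×
  (∀ (y : Fin n) → (ColIn S y → ColIn T y) × (ColIn T y → ColIn S y))

DisjointSubmatrices : ∀ {m n p q p′ q′} {M : Matrix m n} {N : Matrix p q} {N′ : Matrix p′ q′} →
  Submatrix M N → Submatrix M N′ → Set
DisjointSubmatrices {m} {n} S T =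
  (∀ (x : Fin m) → RowIn S x → ¬ RowIn T x) ×
  (∀ (y : Fin n) → ColIn S y → ¬ ColIn T y)

fromRows : ∀ {p q} → Vec (Vec Bool q) p → Matrix p q
fromRows V i j = lookup (lookup V i) j

private
  1′ 0′ : Bool
  1′ = true
  0′ = false

M2₁ : Matrix 4 4
M2₁ = fromRows ( (1′ ∷ 1′ ∷ 0′ ∷ 0′ ∷ [])
               ∷ (0′ ∷ 1′ ∷ 1′ ∷ 0′ ∷ [])
               ∷ (0′ ∷ 1′ ∷ 1′ ∷ 1′ ∷ [])
               ∷ (1′ ∷ 1′ ∷ 0′ ∷ 1′ ∷ []) ∷ [])

M2₂ : Matrix 5 5
M2₂ = fromRows ( (1′ ∷ 1′ ∷ 0′ ∷ 0′ ∷ 0′ ∷ [])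
               ∷ (0′ ∷ 1′ ∷ 1′ ∷ 0′ ∷ 0′ ∷ [])
               ∷ (0′ ∷ 0′ ∷ 1′ ∷ 1′ ∷ 0′ ∷ [])
               ∷ (0′ ∷ 1′ ∷ 1′ ∷ 1′ ∷ 1′ ∷ [])
               ∷ (1′ ∷ 1′ ∷ 1′ ∷ 0′ ∷ 1′ ∷ []) ∷ [])

M3₁ : Matrix 3 4
M3₁ = fromRows ( (1′ ∷ 1′ ∷ 0′ ∷ 0′ ∷ [])
               ∷ (0′ ∷ 1′ ∷ 1′ ∷ 0′ ∷ [])
               ∷ (0′ ∷ 1′ ∷ 0′ ∷ 1′ ∷ []) ∷ [])

M3₂ : Matrix 4 5
M3₂ = fromRows ( (1′ ∷ 1′ ∷ 0′ ∷ 0′ ∷ 0′ ∷ [])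
               ∷ (0′ ∷ 1′ ∷ 1′ ∷ 0′ ∷ 0′ ∷ [])
               ∷ (0′ ∷ 0′ ∷ 1′ ∷ 1′ ∷ 0′ ∷ [])
               ∷ (0′ ∷ 1′ ∷ 1′ ∷ 0′ ∷ 1′ ∷ []) ∷ [])

M3₃ : Matrix 5 6
M3₃ = fromRows ( (1′ ∷ 1′ ∷ 0′ ∷ 0′ ∷ 0′ ∷ 0′ ∷ [])
               ∷ (0′ ∷ 1′ ∷ 1′ ∷ 0′ ∷ 0′ ∷ 0′ ∷ [])
               ∷ (0′ ∷ 0′ ∷ 1′ ∷ 1′ ∷ 0′ ∷ 0′ ∷ [])
               ∷ (0′ ∷ 0′ ∷ 0′ ∷ 1′ ∷ 1′ ∷ 0′ ∷ [])
               ∷ (0′ ∷ 1′ ∷ 1′ ∷ 1′ ∷ 0′ ∷ 1′ ∷ []) ∷ [])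

-- M_{I_k}: (k+2)×(k+2); with 0-based indices, row i (0 ≤ i ≤ k) has ones exactly in
-- columns i and i+1, and row k+1 has ones exactly in columns 0 and k+1.
MI : (k : ℕ) → Matrix (k + 2) (k + 2)
MI k i j =
  if toℕ i ≤ᵇ k
  then ((toℕ j ≡ᵇ toℕ i) ∨ (toℕ j ≡ᵇ suc (toℕ i)))
  else ((toℕ j ≡ᵇ 0) ∨ (toℕ j ≡ᵇ suc k))

orient : ∀ {p} → Bool → Matrix p p → Matrix p p
orient false N = N
orient true  N = transpose N

module Submission where

-- For a (2,*)-matrix M read the rows as vertices and the columns as
-- edges of a graph (a column joins the at most two rows where it has its ones).
-- A copy of M_{I_k} or of its transpose is a cycle in this picture; all the
-- argument uses is that such a matrix is "cycle-like": every row and every column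
-- has two ones, and its row/column incidence graph is connected.  Since M contains
-- no M3₁ᵀ (a row with three edges leading to three further rows, i.e. a claw) and
-- has no identical columns (no parallel edges), a cycle-like submatrix T that
-- shares one row with a cycle-like submatrix S cannot leave S: from a shared row
-- every further one of T lies in a column of S (else a claw appears), and a shared
-- column forces the rows of its ones into S (a column has only two ones).  By
-- connectivity all of T lies in S, and symmetrically, so S and T are the same
-- submatrix; if they share no row they cannot share a column either, so they are
-- disjoint.  The (*,2) case is the (2,*) case for the transpose.

open import Defs
open import Data.Bool using (Bool; true; false; _∨_; T; if_then_else_)
open import Data.Bool.Properties using (T-≡; ∨-zeroʳ)
open import Data.Nat using (ℕ; zero; suc; _+_; _≤_; _<_; _<ᵇ_; _≡ᵇ_; z≤n; s≤s; s≤s⁻¹)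
open import Data.Nat.Properties using (+-comm; +-suc; ≤-trans; n≮n; ≤⇒≤ᵇ; ≡⇒≡ᵇ; n≤1+n; ≤-refl; 1+n≢0; 0≢1+n; 1+n≢n; m≤n⇒m<n∨m≡n)
open import Data.Fin using (Fin; toℕ; fromℕ<)
open import Data.Fin.Patterns using (0F; 1F; 2F; 3F)
open import Data.Fin.Properties using (toℕ-fromℕ<; toℕ-injective; toℕ<n; _≟_; any?)
open import Data.Vec using (Vec; []; _∷_; lookup)
open import Data.Vec.Relation.Unary.All using (All; []; _∷_)
open import Data.Vec.Relation.Unary.Unique.Propositional using (Unique; []; _∷_)
open import Data.Vec.Relation.Unary.Unique.Propositional.Properties using (lookup-injective)
open import Data.Product using (Σ; _×_; _,_)
open import Data.Sum using (_⊎_; inj₁; inj₂)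
open import Data.Empty using (⊥; ⊥-elim)
open import Function using (_∘_)
open import Function.Bundles using (Equivalence)
open import Relation.Binary.PropositionalEquality
open import Relation.Nullary using (¬_; yes; no; does)

clear : ∀ {n} → (Fin n → Bool) → Fin n → Fin n → Bool
clear f a i = if does (i ≟ a) then false else f i

clear-elsewhere : ∀ {n} (f : Fin n → Bool) {a i} → i ≢ a → clear f a i ≡ f i
clear-elsewhere f {a} {i} i≢a with i ≟ a
... | yes i≡a = ⊥-elim (i≢a i≡a)
... | no _    = refl

countOnes-clear : ∀ {n} (f : Fin n → Bool) a → f a ≡ true → countOnes f ≡ suc (countOnes (clear f a))
countOnes-clear f Fin.zero    fa rewrite fa = refl
countOnes-clear f (Fin.suc a) fa = begin
  first + countOnes (f ∘ Fin.suc)                      ≡⟨ cong (first +_) (countOnes-clear (f ∘ Fin.suc) a fa) ⟩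
  first + suc (countOnes (clear (f ∘ Fin.suc) a))      ≡⟨ +-suc first _ ⟩
  suc (first + countOnes (clear (f ∘ Fin.suc) a))      ∎
  where
    open ≡-Reasoning
    first : ℕ
    first = if f Fin.zero then 1 else 0

countOnes-≥ : ∀ {n k} (f : Fin n → Bool) (xs : Vec (Fin n) k) →
  Unique xs → All (λ i → f i ≡ true) xs → k ≤ countOnes f
countOnes-≥ f []       _            _          = z≤n
countOnes-≥ f (x ∷ xs) (x∉xs ∷ uxs) (fx ∷ fxs) =
  subst (_ ≤_) (sym (countOnes-clear f x fx)) (s≤s (countOnes-≥ (clear f x) xs uxs (kept x∉xs fxs)))
  where
    kept : ∀ {k} {ys : Vec (Fin _) k} → All (x ≢_) ys → All (λ i → f i ≡ true) ys → All (λ i → clear f x i ≡ true) ys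
    kept []           []         = []
    kept (x≢y ∷ x≢ys) (fy ∷ fys) = trans (clear-elsewhere f (x≢y ∘ sym)) fy ∷ kept x≢ys fys

HasTwoOnes : ∀ {n} → (Fin n → Bool) → Set
HasTwoOnes {n} v = Σ (Fin n) λ j → Σ (Fin n) λ j′ → j ≢ j′ × v j ≡ true × v j′ ≡ true

another-one : ∀ {n} {v : Fin n → Bool} → HasTwoOnes v → ∀ {i} → v i ≡ true →
  Σ (Fin n) λ i′ → i′ ≢ i × v i′ ≡ true
another-one (j , j′ , j≢j′ , vj , vj′) {i} vi with i ≟ j
... | yes refl = j′ , j≢j′ ∘ sym , vj′
... | no i≢j   = j , i≢j ∘ sym , vj

-- The row/column incidence graph of N (row i adjacent to column j iff N i j = 1) is
-- connected, phrased as an induction principle: predicates on rows and columns that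
-- are closed under adjacency and hold at one row hold everywhere.
Connected : ∀ {p q} → Matrix p q → Set₁
Connected {p} {q} N = (PR : Fin p → Set) (PC : Fin q → Set) →
  (∀ i j → N i j ≡ true → PR i → PC j) → (∀ i j → N i j ≡ true → PC j → PR i) →
  ∀ i₀ → PR i₀ → (∀ i → PR i) × (∀ j → PC j)

record CycleLike {p q} (N : Matrix p q) : Set₁ where
  field
    rows-two  : ∀ i → HasTwoOnes (N i)
    cols-two  : ∀ j → HasTwoOnes (λ i → N i j)
    connected : Connected N
open CycleLike

-- Cycle-likeness is symmetric in rows and columns; for connectivity of the transpose
-- start from a row having a one in the given column.
CycleLike-transpose : ∀ {p q} {N : Matrix p q} → CycleLike N → CycleLike (transpose N)
CycleLike-transpose c = record
  { rows-two  = cols-two c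
  ; cols-two  = rows-two c
  ; connected = λ PR PC closedRC closedCR j₀ prj₀ →
      let (i₀ , _ , _ , N-i₀j₀ , _) = cols-two c j₀
          (allC , allR) = connected c PC PR (λ i j e → closedCR j i e) (λ i j e → closedRC j i e)
                                      i₀ (closedRC j₀ i₀ N-i₀j₀ prj₀)
      in allR , allC
  }

module CycleMatrix (k : ℕ) where

  Index : Set
  Index = Fin (k + 2)

  index-bound : (i : Index) → toℕ i ≤ suc k
  index-bound i = s≤s⁻¹ (subst (toℕ i <_) (+-comm k 2) (toℕ<n i))

  index : ∀ a → a ≤ suc k → Index
  index a a≤1+k = fromℕ< (subst (a <_) (sym (+-comm k 2)) (s≤s a≤1+k))

  toℕ-index : ∀ a (a≤1+k : a ≤ suc k) → toℕ (index a a≤1+k) ≡ a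
  toℕ-index a a≤1+k = toℕ-fromℕ< _

  row-kind : (i : Index) → toℕ i ≤ k ⊎ toℕ i ≡ suc k
  row-kind i with m≤n⇒m<n∨m≡n (index-bound i)
  ... | inj₁ i<1+k = inj₁ (s≤s⁻¹ i<1+k)
  ... | inj₂ i≡1+k = inj₂ i≡1+k

  private
    true-if : ∀ {b} → T b → b ≡ true
    true-if = Equivalence.to T-≡

    ∨-left : ∀ a b c d → a ≡ b → ((a ≡ᵇ b) ∨ (c ≡ᵇ d)) ≡ true
    ∨-left a b _ _ a≡b rewrite true-if (≡⇒≡ᵇ a b a≡b) = refl

    ∨-right : ∀ a b c d → c ≡ d → ((a ≡ᵇ b) ∨ (c ≡ᵇ d)) ≡ true
    ∨-right a b c d c≡d rewrite true-if (≡⇒≡ᵇ c d c≡d) = ∨-zeroʳ (a ≡ᵇ b)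

    <ᵇ-irrefl : ∀ n → (n <ᵇ n) ≡ false
    <ᵇ-irrefl zero    = refl
    <ᵇ-irrefl (suc n) = <ᵇ-irrefl n

  MI-upper : ∀ {i} j → toℕ i ≤ k → MI k i j ≡ ((toℕ j ≡ᵇ toℕ i) ∨ (toℕ j ≡ᵇ suc (toℕ i)))
  MI-upper {i} j i≤k rewrite true-if (≤⇒≤ᵇ i≤k) = refl

  MI-last : ∀ {i} j → toℕ i ≡ suc k → MI k i j ≡ ((toℕ j ≡ᵇ 0) ∨ (toℕ j ≡ᵇ suc k))
  MI-last {i} j i≡1+k rewrite i≡1+k | <ᵇ-irrefl k = refl

  MI-diag : ∀ i → MI k i i ≡ true
  MI-diag i with row-kind i
  ... | inj₁ i≤k   = trans (MI-upper i i≤k) (∨-left (toℕ i) (toℕ i) (toℕ i) (suc (toℕ i)) refl)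
  ... | inj₂ i≡1+k = trans (MI-last i i≡1+k) (∨-right (toℕ i) 0 (toℕ i) (suc k) i≡1+k)

  MI-next : ∀ {i j} → toℕ i ≤ k → toℕ j ≡ suc (toℕ i) → MI k i j ≡ true
  MI-next {i} {j} i≤k j≡1+i = trans (MI-upper j i≤k) (∨-right (toℕ j) (toℕ i) (toℕ j) (suc (toℕ i)) j≡1+i)

  MI-corner : ∀ {i j} → toℕ i ≡ suc k → toℕ j ≡ 0 → MI k i j ≡ true
  MI-corner {i} {j} i≡1+k j≡0 = trans (MI-last j i≡1+k) (∨-left (toℕ j) 0 (toℕ j) (suc k) j≡0)

  previous-row : ∀ j a → toℕ j ≡ suc a → Σ Index λ i → toℕ i ≡ a × MI k i j ≡ true
  previous-row j a j≡1+a =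
    index a a≤1+k , toℕ-index a a≤1+k ,
    MI-next (subst (_≤ k) (sym (toℕ-index a a≤1+k)) a≤k)
            (trans j≡1+a (cong suc (sym (toℕ-index a a≤1+k))))
    where
      a≤k : a ≤ k
      a≤k = s≤s⁻¹ (subst (_≤ suc k) j≡1+a (index-bound j))
      a≤1+k : a ≤ suc k
      a≤1+k = ≤-trans a≤k (n≤1+n k)

  ≢-index : ∀ {i} a (a≤1+k : a ≤ suc k) → toℕ i ≢ a → i ≢ index a a≤1+k
  ≢-index a a≤1+k i≢a i≡index = i≢a (trans (cong toℕ i≡index) (toℕ-index a a≤1+k))

  MI-rows-two : ∀ i → HasTwoOnes (MI k i)
  MI-rows-two i with row-kind i
  ... | inj₁ i≤k   = i , index (suc (toℕ i)) (s≤s i≤k) , ≢-index _ (s≤s i≤k) (1+n≢n ∘ sym) ,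
                     MI-diag i , MI-next i≤k (toℕ-index _ (s≤s i≤k))
  ... | inj₂ i≡1+k = i , index 0 z≤n , ≢-index 0 z≤n (1+n≢0 ∘ trans (sym i≡1+k)) ,
                     MI-diag i , MI-corner i≡1+k (toℕ-index 0 z≤n)

  MI-cols-two : ∀ j → HasTwoOnes (λ i → MI k i j)
  MI-cols-two j = column (toℕ j) refl
    where
      column : ∀ a → toℕ j ≡ a → HasTwoOnes (λ i → MI k i j)
      column zero    j≡0   = j , index (suc k) ≤-refl , ≢-index (suc k) ≤-refl (0≢1+n ∘ trans (sym j≡0)) ,
                             MI-diag j , MI-corner (toℕ-index (suc k) ≤-refl) j≡0
      column (suc a) j≡1+a = let (i , i≡a , MI-ij) = previous-row j a j≡1+a in
                             j , i , (λ j≡i → 1+n≢n (trans (sym j≡1+a) (trans (cong toℕ j≡i) i≡a))) ,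
                             MI-diag j , MI-ij

  -- consecutive rows share a column, so every row is linked to the first one
  MI-connected : Connected (MI k)
  MI-connected PR PC closedRC closedCR i₀ PR-i₀ = all-rows , all-cols
    where
      first : Index
      first = index 0 z≤n

      across : ∀ {i i′} j → MI k i j ≡ true → MI k i′ j ≡ true → PR i → PR i′
      across {i} {i′} j MI-ij MI-i′j = closedCR i′ j MI-i′j ∘ closedRC i j MI-ij

      is-first : ∀ {i} → toℕ i ≡ 0 → first ≡ i
      is-first i≡0 = toℕ-injective (trans (toℕ-index 0 z≤n) (sym i≡0))

      descend : ∀ a i → toℕ i ≡ a → PR i → PR first
      descend zero    i i≡0   = subst PR (sym (is-first i≡0))
      descend (suc a) i i≡1+a = let (i′ , i′≡a , MI-i′i) = previous-row i a i≡1+a in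
                                descend a i′ i′≡a ∘ across i (MI-diag i) MI-i′i

      ascend : ∀ a i → toℕ i ≡ a → PR first → PR i
      ascend zero    i i≡0   = subst PR (is-first i≡0)
      ascend (suc a) i i≡1+a = let (i′ , i′≡a , MI-i′i) = previous-row i a i≡1+a in
                               across i MI-i′i (MI-diag i) ∘ ascend a i′ i′≡a

      all-rows : ∀ i → PR i
      all-rows i = ascend (toℕ i) i refl (descend (toℕ i₀) i₀ refl PR-i₀)

      all-cols : ∀ j → PC j
      all-cols j = closedRC j j (MI-diag j) (all-rows j)

  MI-cycleLike : CycleLike (MI k)
  MI-cycleLike = record { rows-two = MI-rows-two ; cols-two = MI-cols-two ; connected = MI-connected }

orient-cycleLike : ∀ k s → CycleLike (orient s (MI k))
orient-cycleLike k false = CycleMatrix.MI-cycleLike k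
orient-cycleLike k true  = CycleLike-transpose (CycleMatrix.MI-cycleLike k)

submatrix-from : ∀ {m n p q} {M : Matrix m n} {N : Matrix p q} (R : Vec (Fin m) p) (C : Vec (Fin n) q) →
  Unique R → Unique C → (∀ i j → M (lookup R i) (lookup C j) ≡ N i j) → Submatrix M N
submatrix-from R C unique-R unique-C matches = record
  { rows     = lookup R
  ; cols     = lookup C
  ; rows-inj = λ {i} {j} → lookup-injective unique-R i j
  ; cols-inj = λ {i} {j} → lookup-injective unique-C i j
  ; match    = matches
  }

Inside : ∀ {m n p q p′ q′} {M : Matrix m n} {N : Matrix p q} {N′ : Matrix p′ q′} →
  Submatrix M N′ → Submatrix M N → Set
Inside T S = (∀ i′ → RowIn S (rows T i′)) × (∀ j′ → ColIn S (cols T j′))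

same-if-mutually-inside : ∀ {m n p q p′ q′} {M : Matrix m n} {N : Matrix p q} {N′ : Matrix p′ q′}
  {S : Submatrix M N} {T : Submatrix M N′} → Inside T S → Inside S T → SameSubmatrix S T
same-if-mutually-inside {S = S} {T} (T-rows , T-cols) (S-rows , S-cols) =
  (λ x → (λ { (i , Si≡x) → subst (RowIn T) Si≡x (S-rows i) }) ,
         (λ { (i′ , Ti′≡x) → subst (RowIn S) Ti′≡x (T-rows i′) })) ,
  (λ y → (λ { (j , Sj≡y) → subst (ColIn T) Sj≡y (S-cols j) }) ,
         (λ { (j′ , Tj′≡y) → subst (ColIn S) Tj′≡y (T-cols j′) }))

-- A (2,*)-matrix read as a graph on its rows, each column being an edge.
module TwoStarMatrix {m n} (M : Matrix m n) (twoStar : TwoStar M) where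

  column-ends : ∀ {u v w c} → u ≢ v → M u c ≡ true → M v c ≡ true → M w c ≡ true → w ≡ u ⊎ w ≡ v
  column-ends {u} {v} {w} {c} u≢v Muc Mvc Mwc with w ≟ u | w ≟ v
  ... | yes w≡u | _       = inj₁ w≡u
  ... | no _    | yes w≡v = inj₂ w≡v
  ... | no w≢u  | no w≢v  = ⊥-elim (n≮n 2 (≤-trans three-ones (twoStar c)))
    where
      three-ones : 3 ≤ countOnes (λ i → M i c)
      three-ones = countOnes-≥ (λ i → M i c) (u ∷ v ∷ w ∷ [])
                     ((u≢v ∷ (w≢u ∘ sym) ∷ []) ∷ ((w≢v ∘ sym) ∷ []) ∷ [] ∷ [])
                     (Muc ∷ Mvc ∷ Mwc ∷ [])

  record EdgeAt (x : Fin m) (c : Fin n) : Set where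
    field
      far      : Fin m
      far≢x    : far ≢ x
      near-one : M x c ≡ true
      far-one  : M far c ≡ true
  open EdgeAt

  off-edge : ∀ {x c} (e : EdgeAt x c) {w} → w ≢ x → w ≢ far e → M w c ≡ false
  off-edge {x} {c} e {w} w≢x w≢far with M w c in Mwc
  ... | false = refl
  ... | true with column-ends (far≢x e ∘ sym) (near-one e) (far-one e) Mwc
  ...   | inj₁ w≡x   = ⊥-elim (w≢x w≡x)
  ...   | inj₂ w≡far = ⊥-elim (w≢far w≡far)

  -- Without identical columns and without M3₁ᵀ the graph is simple and claw-free.
  module ClawFree (noIdenticalCols : NoIdenticalCols M) (noClaw : ¬ Contains M (transpose M3₁)) where

    parallel-columns : ∀ {u v c c′} → u ≢ v → M u c ≡ true → M v c ≡ true →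
      M u c′ ≡ true → M v c′ ≡ true → c ≡ c′
    parallel-columns {u} {v} {c} {c′} u≢v Muc Mvc Muc′ Mvc′ = noIdenticalCols c c′ same-column
      where
        same-column : ∀ w → M w c ≡ M w c′
        same-column w with w ≟ u | w ≟ v
        ... | yes refl | _        = trans Muc (sym Muc′)
        ... | no _     | yes refl = trans Mvc (sym Mvc′)
        ... | no w≢u   | no w≢v   = trans (off-edge e w≢u w≢v) (sym (off-edge e′ w≢u w≢v))
          where
            e  = record { far = v ; far≢x = u≢v ∘ sym ; near-one = Muc  ; far-one = Mvc  }
            e′ = record { far = v ; far≢x = u≢v ∘ sym ; near-one = Muc′ ; far-one = Mvc′ }

    distinct-ends : ∀ {x c c′} (e : EdgeAt x c) (e′ : EdgeAt x c′) → c ≢ c′ → far e ≢ far e′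
    distinct-ends e e′ c≢c′ far≡far′ =
      c≢c′ (parallel-columns (far≢x e ∘ sym) (near-one e) (far-one e) (near-one e′)
                             (subst (λ w → M w _ ≡ true) (sym far≡far′) (far-one e′)))

    -- no row carries three distinct edges: they would span a copy of M3₁ᵀ
    no-claw : ∀ {x c₁ c₂ c₃} → EdgeAt x c₁ → EdgeAt x c₂ → EdgeAt x c₃ →
      c₁ ≢ c₂ → c₁ ≢ c₃ → c₂ ≢ c₃ → ⊥
    no-claw {x} {c₁} {c₂} {c₃} e₁ e₂ e₃ c₁≢c₂ c₁≢c₃ c₂≢c₃ =
      noClaw (submatrix-from (a ∷ x ∷ b ∷ c ∷ []) (c₁ ∷ c₂ ∷ c₃ ∷ []) unique-rows unique-cols claw)
      where
        a = far e₁
        b = far e₂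
        c = far e₃
        a≢b = distinct-ends e₁ e₂ c₁≢c₂
        a≢c = distinct-ends e₁ e₃ c₁≢c₃
        b≢c = distinct-ends e₂ e₃ c₂≢c₃

        unique-rows : Unique (a ∷ x ∷ b ∷ c ∷ [])
        unique-rows = (far≢x e₁ ∷ a≢b ∷ a≢c ∷ []) ∷ ((far≢x e₂ ∘ sym) ∷ (far≢x e₃ ∘ sym) ∷ []) ∷ (b≢c ∷ []) ∷ [] ∷ []

        unique-cols : Unique (c₁ ∷ c₂ ∷ c₃ ∷ [])
        unique-cols = (c₁≢c₂ ∷ c₁≢c₃ ∷ []) ∷ (c₂≢c₃ ∷ []) ∷ [] ∷ []

        claw : ∀ i j → M (lookup (a ∷ x ∷ b ∷ c ∷ []) i) (lookup (c₁ ∷ c₂ ∷ c₃ ∷ []) j) ≡ transpose M3₁ i j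
        claw 0F 0F = far-one e₁
        claw 0F 1F = off-edge e₂ (far≢x e₁) a≢b
        claw 0F 2F = off-edge e₃ (far≢x e₁) a≢c
        claw 1F 0F = near-one e₁
        claw 1F 1F = near-one e₂
        claw 1F 2F = near-one e₃
        claw 2F 0F = off-edge e₁ (far≢x e₂) (a≢b ∘ sym)
        claw 2F 1F = far-one e₂
        claw 2F 2F = off-edge e₃ (far≢x e₂) b≢c
        claw 3F 0F = off-edge e₁ (far≢x e₃) (a≢c ∘ sym)
        claw 3F 1F = off-edge e₂ (far≢x e₃) (b≢c ∘ sym)
        claw 3F 2F = far-one e₃

    edge-in : ∀ {p q} {N : Matrix p q} → CycleLike N → (S : Submatrix M N) →
      ∀ {i j} → N i j ≡ true → EdgeAt (rows S i) (cols S j)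
    edge-in cN S {i} {j} Nij with another-one (cols-two cN j) Nij
    ... | i′ , i′≢i , Ni′j = record
      { far = rows S i′ ; far≢x = i′≢i ∘ rows-inj S
      ; near-one = trans (match S i j) Nij ; far-one = trans (match S i′ j) Ni′j }

    module Overlap {p q p′ q′} {N : Matrix p q} {N′ : Matrix p′ q′} (cN : CycleLike N) (cN′ : CycleLike N′)
                   (S : Submatrix M N) (T : Submatrix M N′) where

      -- at a row shared with S, the ones of T lie in columns of S: a third edge would form a claw
      row-to-column : ∀ {i′ j′} → N′ i′ j′ ≡ true → RowIn S (rows T i′) → ColIn S (cols T j′)
      row-to-column {i′} {j′} N′i′j′ (i , Si≡Ti′) with rows-two cN i
      ... | j₁ , j₂ , j₁≢j₂ , Nij₁ , Nij₂ with cols T j′ ≟ cols S j₁ | cols T j′ ≟ cols S j₂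
      ...   | yes Tj′≡Sj₁ | _           = j₁ , sym Tj′≡Sj₁
      ...   | no _        | yes Tj′≡Sj₂ = j₂ , sym Tj′≡Sj₂
      ...   | no Tj′≢Sj₁  | no Tj′≢Sj₂  =
        ⊥-elim (no-claw (edge-in cN S Nij₁) (edge-in cN S Nij₂) third-edge
                        (j₁≢j₂ ∘ cols-inj S) (Tj′≢Sj₁ ∘ sym) (Tj′≢Sj₂ ∘ sym))
        where
          third-edge : EdgeAt (rows S i) (cols T j′)
          third-edge = subst (λ x → EdgeAt x (cols T j′)) (sym Si≡Ti′) (edge-in cN′ T N′i′j′)

      -- at a column shared with S, the ones of T lie in rows of S: a column has only two ones
      column-to-row : ∀ {i′ j′} → N′ i′ j′ ≡ true → ColIn S (cols T j′) → RowIn S (rows T i′)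
      column-to-row {i′} {j′} N′i′j′ (j , Sj≡Tj′) with cols-two cN j
      ... | i₁ , i₂ , i₁≢i₂ , Ni₁j , Ni₂j
          with column-ends (i₁≢i₂ ∘ rows-inj S) (trans (match S i₁ j) Ni₁j) (trans (match S i₂ j) Ni₂j)
                           (subst (λ y → M (rows T i′) y ≡ true) (sym Sj≡Tj′) (trans (match T i′ j′) N′i′j′))
      ...   | inj₁ Ti′≡Si₁ = i₁ , sym Ti′≡Si₁
      ...   | inj₂ Ti′≡Si₂ = i₂ , sym Ti′≡Si₂

      -- by connectivity of N′, one shared row puts all of T inside S
      shared-row-inside : ∀ i′ → RowIn S (rows T i′) → Inside T S
      shared-row-inside = connected cN′ (λ i′ → RowIn S (rows T i′)) (λ j′ → ColIn S (cols T j′))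
                                    (λ _ _ → row-to-column) (λ _ _ → column-to-row)

    overlap-dichotomy : ∀ {p q p′ q′} {N : Matrix p q} {N′ : Matrix p′ q′} → CycleLike N → CycleLike N′ →
      (S : Submatrix M N) (T : Submatrix M N′) → SameSubmatrix S T ⊎ DisjointSubmatrices S T
    overlap-dichotomy cN cN′ S T with any? (λ i′ → any? (λ i → rows S i ≟ rows T i′))
    ... | yes (i′ , i , Si≡Ti′) =
      inj₁ (same-if-mutually-inside {S = S} {T} (Overlap.shared-row-inside cN cN′ S T i′ (i , Si≡Ti′))
                                    (Overlap.shared-row-inside cN′ cN T S i (i′ , sym Si≡Ti′)))
    ... | no no-shared-row = inj₂ (rows-disjoint , cols-disjoint)
      where
        rows-disjoint : ∀ x → RowIn S x → ¬ RowIn T x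
        rows-disjoint x (i , Si≡x) (i′ , Ti′≡x) = no-shared-row (i′ , i , trans Si≡x (sym Ti′≡x))

        -- a shared column would give a shared row
        cols-disjoint : ∀ y → ColIn S y → ¬ ColIn T y
        cols-disjoint y (j , Sj≡y) (j′ , Tj′≡y) =
          let (i′ , _ , _ , N′i′j′ , _) = cols-two cN′ j′
          in no-shared-row (i′ , Overlap.column-to-row cN cN′ S T N′i′j′ (j , trans Sj≡y (sym Tj′≡y)))

transpose-submatrix : ∀ {m n p q} {M : Matrix m n} {N : Matrix p q} →
  Submatrix M N → Submatrix (transpose M) (transpose N)
transpose-submatrix S = record
  { rows = cols S ; cols = rows S ; rows-inj = cols-inj S ; cols-inj = rows-inj S
  ; match = λ i j → match S j i }

untranspose-dichotomy : ∀ {m n p q p′ q′} {M : Matrix m n} {N : Matrix p q} {N′ : Matrix p′ q′}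
  {S : Submatrix M N} {T : Submatrix M N′} →
  SameSubmatrix (transpose-submatrix S) (transpose-submatrix T) ⊎
    DisjointSubmatrices (transpose-submatrix S) (transpose-submatrix T) →
  SameSubmatrix S T ⊎ DisjointSubmatrices S T
untranspose-dichotomy (inj₁ (same-cols , same-rows))         = inj₁ (same-rows , same-cols)
untranspose-dichotomy (inj₂ (disjoint-cols , disjoint-rows)) = inj₂ (disjoint-rows , disjoint-cols)

-- Copies of M_{I_k} and M_{I_k}ᵀ are cycle-like, so the dichotomy applies to M in
-- the (2,*) case and to Mᵀ in the (*,2) case.
theorem9 : ∀ {m n} (M : Matrix m n) →
    (TwoStar M ⊎ StarTwo M) →
    NoIdenticalRows M → NoIdenticalCols M →
    ¬ SC1P M →
    ¬ Contains M M2₁ → ¬ Contains M M2₂ →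
    ¬ Contains M M3₁ → ¬ Contains M M3₂ → ¬ Contains M M3₃ →
    ¬ Contains M (transpose M2₁) → ¬ Contains M (transpose M2₂) →
    ¬ Contains M (transpose M3₁) → ¬ Contains M (transpose M3₂) →
    ¬ Contains M (transpose M3₃) →
    (k l : ℕ) → 1 ≤ k → 1 ≤ l → (s t : Bool) →
    (S : Submatrix M (orient s (MI k))) → (T : Submatrix M (orient t (MI l))) →
    SameSubmatrix S T ⊎ DisjointSubmatrices S T
theorem9 M (inj₁ twoStar) _ noIdenticalCols _ _ _ _ _ _ _ _ noM3₁ᵀ _ _ k l _ _ s t S T =
  TwoStarMatrix.ClawFree.overlap-dichotomy M twoStar noIdenticalCols noM3₁ᵀ
    (orient-cycleLike k s) (orient-cycleLike l t) S T
theorem9 M (inj₂ starTwo) noIdenticalRows _ _ _ _ noM3₁ _ _ _ _ _ _ _ k l _ _ s t S T =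
  untranspose-dichotomy {S = S} {T}
    (TwoStarMatrix.ClawFree.overlap-dichotomy (transpose M) starTwo noIdenticalRows
      (noM3₁ ∘ transpose-submatrix)
      (CycleLike-transpose (orient-cycleLike k s)) (CycleLike-transpose (orient-cycleLike l t))
      (transpose-submatrix S) (transpose-submatrix T))
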